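{- Let $G$ be a graph, let $T=(t_1,t_2,\dots,t_{2l})$ be a path in $G$, and let $W$ be a set of vertices of $G$ disjoint from $T$. Let $Q_1=(t_1,t_2)$, $Q_i=(t_{2i-3},t_{2i-2},t_{2i-1},t_{2i})$ for $1<i\le l$, and $Q_{l+1}=(t_{2l-1},t_{2l})$. If there is an ordering $\sigma$ of $[l+1]$ such that for each $i$ the vertices of $Q_{\sigma(i)}$ have at least $i$ common neighbours in $W$, then $G$ contains a squared path $(q_1,t_1,t_2,q_2,t_3,t_4,q_3,\dots,t_{2l},q_{l+1})$ with $q_i\in W$ for each $i$, using every vertex of $T$. If instead $T=(t_1,\dots,t_{2l})$ is a cycle on $2l$ vertices, and we let $Q_1=(t_{2l-1},t_{2l},t_1,t_2)$, $Q_i=(t_{2i-3},t_{2i-2},t_{2i-1},t_{2i})$ for $1<i\le l$, and $\sigma$ be an ordering of $[l]$ such that for each $i$ the vertices of $Q_{\sigma(i)}$ have at least $i$ common neighbours in $W$, then $G$ contains a squared cycle $C^2_{3l}$ (namely $(q_1,t_1,t_2,q_2,\dots,q_l,t_{2l-1},t_{2l})$ with $q_i\in W$).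
   Context: A squared path $(x_1,\dots,x_s)$ is a sequence of distinct vertices such that $x_i$ is adjacent to $x_j$ whenever $1\le|i-j|\le2$, i.e. a copy of the square of a path (the square of a graph $F$ adds edges between vertices at distance 2 in $F$). $C^2_s$ denotes the square of a cycle on $s$ vertices. -}

module Defs where

open import Data.Nat using (ℕ; zero; suc; _+_; _*_; _∸_; _≤_; _<_; _≤ᵇ_)
open import Data.Fin using (Fin; toℕ)
open import Data.List using (List; []; _∷_; _++_; length; lookup; concatMap; upTo; map)
open import Data.List.Relation.Unary.All using (All)
open import Data.List.Relation.Unary.Unique.Propositional using (Unique)
open import Data.Product using (Σ; _×_)
open import Data.Sum using (_⊎_)
open import Data.Bool using (if_then_else_)
open import Function.Definitions using (Injective)
open import Relation.Binary.PropositionalEquality using (_≡_)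
open import Relation.Nullary using (¬_)

record Graph (n : ℕ) : Set₁ where
  field
    Adj    : Fin n → Fin n → Set
    sym    : ∀ {x y} → Adj x y → Adj y x
    irrefl : ∀ {x} → ¬ Adj x x
open Graph public

module _ {n : ℕ} (G : Graph n) where

  AtLeastCommonNbrsIn : (Fin n → Set) → ℕ → List (Fin n) → Set
  AtLeastCommonNbrsIn W m vs =
    Σ (Fin m → Fin n) λ f → Injective _≡_ _≡_ f ×
      (∀ k → W (f k) × All (λ v → Adj G (f k) v) vs)

  SquaredPath : List (Fin n) → Set
  SquaredPath xs = Unique xs ×
    (∀ (i j : Fin (length xs)) → toℕ i < toℕ j → toℕ j ≤ toℕ i + 2 →
       Adj G (lookup xs i) (lookup xs j))

  SquaredCycle : List (Fin n) → Set
  SquaredCycle xs = Unique xs ×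
    (∀ (i j : Fin (length xs)) (d : ℕ) → 1 ≤ d → d ≤ 2 →
       (toℕ i + d ≡ toℕ j ⊎ toℕ i + d ≡ toℕ j + length xs) →
       Adj G (lookup xs i) (lookup xs j))

  -- t : ℕ → Fin n, read at indices 1..s, is a path (t_1,...,t_s) in G.
  IsPath : ℕ → (ℕ → Fin n) → Set
  IsPath s t =
    (∀ a b → 1 ≤ a → a ≤ s → 1 ≤ b → b ≤ s → t a ≡ t b → a ≡ b) ×
    (∀ a → 1 ≤ a → a < s → Adj G (t a) (t (suc a)))

  IsCycle : ℕ → (ℕ → Fin n) → Set
  IsCycle s t = 3 ≤ s × IsPath s t × Adj G (t s) (t 1)

-- Index lists (1-based indices into t) of the sets Q_i for the path case:
-- Q_1 = (t1,t2), Q_i = (t_{2i-3},...,t_{2i}) for 1 < i ≤ l, Q_{l+1} = (t_{2l-1},t_{2l}).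
QPathIdx : ℕ → ℕ → List ℕ
QPathIdx l zero = []
QPathIdx l (suc zero) = 1 ∷ 2 ∷ []
QPathIdx l (suc (suc j)) =
  if suc (suc j) ≤ᵇ l
  then (2 * j + 1) ∷ (2 * j + 2) ∷ (2 * j + 3) ∷ (2 * j + 4) ∷ []
  else (2 * l ∸ 1) ∷ (2 * l) ∷ []

QCycleIdx : ℕ → ℕ → List ℕ
QCycleIdx l zero = []
QCycleIdx l (suc zero) = (2 * l ∸ 1) ∷ (2 * l) ∷ 1 ∷ 2 ∷ []
QCycleIdx l (suc (suc j)) = (2 * j + 1) ∷ (2 * j + 2) ∷ (2 * j + 3) ∷ (2 * j + 4) ∷ []

interleave : {A : Set} → ℕ → (ℕ → A) → (ℕ → A) → List A
interleave l q t =
  concatMap (λ j → q (suc j) ∷ t (2 * j + 1) ∷ t (2 * j + 2) ∷ []) (upTo l)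

-- The common neighbours q_i are chosen greedily in the order σ: the k-th set in that order has
-- at least k common neighbours in W and only k - 1 vertices are used before it, so a fresh one
-- remains (pigeonhole). In (q₁, t₁, t₂, q₂, t₃, t₄, …) each q_i stands between the pairs
-- (t_{2i-3}, t_{2i-2}) and (t_{2i-1}, t_{2i}), both of which lie in Q_i; every other pair of
-- entries at distance at most 2 is an edge of T. The entries are distinct because q is
-- injective, T is a path and W avoids T. For the cycle, Q₁ also contains the last pair of T,
-- which with the closing edge t_{2l} t₁ provides the adjacencies across the wrap-around.
module Submission where

open import Defs hiding (sym)
open import Data.Nat using (ℕ; zero; suc; _+_; _*_; _∸_; _≤_; _<_; z≤n; s≤s; _≤ᵇ_)
open import Data.Nat.Tactic.RingSolver using (solve-∀)
open import Data.Nat.Properties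
  using (≤-refl; ≤-trans; ≤-antisym; ≤-pred; ≤-reflexive; <-trans; <-≤-trans; <-irrefl; <⇒≢; <⇒≱;
         ≰⇒>; n<1+n; n≤1+n; m≤n+m; m<n⇒m<1+n; m≤n⇒m<n∨m≡n; +-comm; +-cancelˡ-≡; +-cancelˡ-≤;
         +-monoʳ-≤; *-suc; *-monoʳ-≤; *-cancelˡ-≡; *-cancelˡ-<; suc-injective; even≢odd;
         ≤ᵇ-reflects-≤; _<?_)
open import Data.Fin using (Fin; toℕ; fromℕ; fromℕ<; inject₁)
open import Data.Fin.Properties
  using (toℕ<n; toℕ-inject₁; toℕ-fromℕ; toℕ-fromℕ<; all?; any?; ¬∀⟶∃¬; pigeonhole)
  renaming (<-irrefl to <-irreflᶠ; _≟_ to _≟ᶠ_)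
open import Data.Fin.Relation.Unary.Top using (view; ‵fromℕ; ‵inject₁)
open import Data.List using (List; []; _∷_; _++_; map; length; lookup; concatMap; applyUpTo; upTo)
open import Data.List.Properties
  using (length-applyUpTo; lookup-applyUpTo; applyUpTo-∷ʳ; map-upTo; concatMap-map; concatMap-cong)
open import Data.List.Relation.Unary.All using (All; []; _∷_)
open import Data.List.Relation.Unary.Unique.Propositional.Properties using (applyUpTo⁺₁)
open import Data.Product using (Σ; _×_; _,_; proj₁; proj₂; ∃)
open import Data.Sum using (_⊎_; inj₁; inj₂)
open import Data.Bool using (true; false)
open import Data.Empty using (⊥-elim)
open import Function using (_∘_)
open import Function.Definitions using (Injective)
open import Function.Bundles using (_↔_; Inverse)
open import Relation.Nullary using (¬_; yes; no)
open import Relation.Nullary.Reflects using (ofⁿ)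
open import Relation.Binary.Definitions using (DecidableEquality)
open import Relation.Binary.PropositionalEquality
  using (_≡_; _≢_; refl; sym; trans; cong; cong₂; subst; subst₂; module ≡-Reasoning)

HasAtLeast : {A : Set} → ℕ → (A → Set) → Set
HasAtLeast {A} m P = Σ (Fin m → A) λ f → Injective _≡_ _≡_ f × ∀ k → P (f k)

DistinctRepresentatives : {A : Set} {m : ℕ} → (Fin m → A → Set) → Set
DistinctRepresentatives {A} {m} P = Σ (Fin m → A) λ g → Injective _≡_ _≡_ g × ∀ i → P i (g i)

module _ {A : Set} (_≟_ : DecidableEquality A) where

  uncovered : ∀ {m k} → m < k → (g : Fin m → A) (f : Fin k → A) → Injective _≡_ _≡_ f →
              ∃ λ y → ∀ x → g x ≢ f y
  uncovered m<k g f f-injective with all? (λ y → any? (λ x → g x ≟ f y))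
  ... | no ¬covered with ¬∀⟶∃¬ _ _ (λ y → any? (λ x → g x ≟ f y)) ¬covered
  ...   | y , ¬hit = y , λ x hit → ¬hit (x , hit)
  uncovered m<k g f f-injective | yes covered with pigeonhole m<k (proj₁ ∘ covered)
  ...   | y , y′ , y<y′ , same = ⊥-elim (<-irreflᶠ (f-injective f-y≡f-y′) y<y′)
    where
    f-y≡f-y′ : f y ≡ f y′
    f-y≡f-y′ = trans (sym (proj₂ (covered y))) (trans (cong g same) (proj₂ (covered y′)))

  snocRepresentative : ∀ {m} {P : Fin (suc m) → A → Set} →
    DistinctRepresentatives (P ∘ inject₁) → HasAtLeast (suc m) (P (fromℕ m)) → DistinctRepresentatives P
  snocRepresentative {m} {P} (g , g-injective , g-represents) (f , f-injective , f-satisfies)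
    with uncovered (n<1+n m) g f f-injective
  ... | y , fresh = h , h-injective , h-represents
    where
    h : Fin (suc m) → A
    h i with view i
    ... | ‵fromℕ = f y
    ... | ‵inject₁ j = g j

    h-injective : Injective _≡_ _≡_ h
    h-injective {i} {i′} eq with view i | view i′
    ... | ‵fromℕ     | ‵fromℕ      = refl
    ... | ‵fromℕ     | ‵inject₁ j′ = ⊥-elim (fresh j′ (sym eq))
    ... | ‵inject₁ j | ‵fromℕ      = ⊥-elim (fresh j eq)
    ... | ‵inject₁ j | ‵inject₁ j′ = cong inject₁ (g-injective eq)

    h-represents : ∀ i → P i (h i)
    h-represents i with view i
    ... | ‵fromℕ = f-satisfies y
    ... | ‵inject₁ j = g-represents j

  greedyRepresentatives : ∀ {m} (P : Fin m → A → Set) →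
    (∀ i → HasAtLeast (suc (toℕ i)) (P i)) → DistinctRepresentatives P
  greedyRepresentatives {zero} P _ = (λ ()) , (λ { {()} }) , (λ ())
  greedyRepresentatives {suc m} P enough = snocRepresentative {P = P}
    (greedyRepresentatives (P ∘ inject₁) λ i →
      subst (λ k → HasAtLeast (suc k) (P (inject₁ i))) (toℕ-inject₁ i) (enough (inject₁ i)))
    (subst (λ k → HasAtLeast (suc k) (P (fromℕ m))) (toℕ-fromℕ m) (enough (fromℕ m)))

  orderedRepresentatives : ∀ {m} (P : Fin m → A → Set) (σ : Fin m ↔ Fin m) →
    (∀ i → HasAtLeast (suc (toℕ i)) (P (Inverse.to σ i))) → DistinctRepresentatives P
  orderedRepresentatives P σ enough with greedyRepresentatives (P ∘ Inverse.to σ) enough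
  ... | g , g-injective , g-represents = g ∘ from , from-injective , represents
    where
    open Inverse σ
    from-injective : Injective _≡_ _≡_ (g ∘ from)
    from-injective {c} {c′} eq = begin
      c             ≡⟨ strictlyInverseˡ c ⟨
      to (from c)   ≡⟨ cong to (g-injective eq) ⟩
      to (from c′)  ≡⟨ strictlyInverseˡ c′ ⟩
      c′            ∎
      where open ≡-Reasoning
    represents : ∀ c → P c (g (from c))
    represents c = subst (λ c′ → P c′ (g (from c))) (strictlyInverseˡ c) (g-represents (from c))

-- Reads h at the 1-based positions 1..m; the value d elsewhere is junk.
oneBased : {A : Set} {m : ℕ} → A → (Fin m → A) → ℕ → A
oneBased d h zero = d
oneBased {m = m} d h (suc j) with j <? m
... | yes j<m = h (fromℕ< j<m)
... | no _ = d

oneBased-suc : {A : Set} {m : ℕ} (d : A) (h : Fin m → A) {j : ℕ} (j<m : j < m) →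
               oneBased d h (suc j) ≡ h (fromℕ< j<m)
oneBased-suc {m = m} d h {j} j<m with j <? m
... | yes _ = refl
... | no j≮m = ⊥-elim (j≮m j<m)

module _ {n : ℕ} (G : Graph n) (W : Fin n → Set) where

  CommonNeighbourChoice : ℕ → (ℕ → List (Fin n)) → (ℕ → Fin n) → Set
  CommonNeighbourChoice m Q q =
    (∀ {j k} → j < m → k < m → q (suc j) ≡ q (suc k) → j ≡ k) ×
    (∀ {j} → j < m → W (q (suc j)) × All (Adj G (q (suc j))) (Q (suc j)))

  chooseCommonNeighbours : ∀ {m} (Q : ℕ → List (Fin n)) (σ : Fin m ↔ Fin m) → Fin n →
    (∀ i → AtLeastCommonNbrsIn G W (suc (toℕ i)) (Q (suc (toℕ (Inverse.to σ i))))) →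
    Σ (ℕ → Fin n) (CommonNeighbourChoice m Q)
  chooseCommonNeighbours {m} Q σ d enough
    with orderedRepresentatives _≟ᶠ_ (λ c v → W v × All (Adj G v) (Q (suc (toℕ c)))) σ enough
  ... | h , h-injective , h-represents = oneBased d h , q-injective , q-represents
    where
    q-injective : ∀ {j k} → j < m → k < m → oneBased d h (suc j) ≡ oneBased d h (suc k) → j ≡ k
    q-injective {j} {k} j< k< eq = begin
      j                    ≡⟨ toℕ-fromℕ< j< ⟨
      toℕ (fromℕ< j<)      ≡⟨ cong toℕ (h-injective
                                (trans (sym (oneBased-suc d h j<)) (trans eq (oneBased-suc d h k<)))) ⟩
      toℕ (fromℕ< k<)      ≡⟨ toℕ-fromℕ< k< ⟩
      k                    ∎
      where open ≡-Reasoning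
    q-represents : ∀ {j} → j < m → W (oneBased d h (suc j)) × All (Adj G (oneBased d h (suc j))) (Q (suc j))
    q-represents {j} j< =
      subst₂ (λ v c → W v × All (Adj G v) (Q (suc c))) (sym (oneBased-suc d h j<)) (toℕ-fromℕ< j<)
        (h-represents (fromℕ< j<))

-- The j-th pair (t_{2j+1}, t_{2j+2}) of T, counting from 0; it lies between q_{j+1} and q_{j+2}.
OnPair : {A : Set} → (A → Set) → (ℕ → A) → ℕ → Set
OnPair P t j = P (t (1 + 2 * j)) × P (t (2 + 2 * j))

private
  2j+1 : ∀ j → 2 * j + 1 ≡ 1 + 2 * j
  2j+1 = solve-∀
  2j+2 : ∀ j → 2 * j + 2 ≡ 2 + 2 * j
  2j+2 = solve-∀
  2j+3 : ∀ j → 2 * j + 3 ≡ 1 + 2 * suc j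
  2j+3 = solve-∀
  2j+4 : ∀ j → 2 * j + 4 ≡ 2 + 2 * suc j
  2j+4 = solve-∀

module _ {A : Set} {P : A → Set} (t : ℕ → A) where

  private
    along : ∀ {a b} → a ≡ b → P (t a) → P (t b)
    along = subst (P ∘ t)

  pair⊆QPath-same : ∀ {l j} → j < l → All P (map t (QPathIdx l (suc j))) → OnPair P t j
  pair⊆QPath-same {l} {zero} _ (p₁ ∷ p₂ ∷ []) = p₁ , p₂
  pair⊆QPath-same {l} {suc j} j<l ps with suc (suc j) ≤ᵇ l | ≤ᵇ-reflects-≤ (suc (suc j)) l | ps
  ... | true  | _          | _ ∷ _ ∷ p₃ ∷ p₄ ∷ [] = along (2j+3 j) p₃ , along (2j+4 j) p₄
  ... | false | ofⁿ 2+j≰l | _ = ⊥-elim (2+j≰l j<l)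

  pair⊆QPath-next : ∀ {l j} → j < l → All P (map t (QPathIdx l (2 + j))) → OnPair P t j
  pair⊆QPath-next {l} {j} j<l ps with suc (suc j) ≤ᵇ l | ≤ᵇ-reflects-≤ (suc (suc j)) l | ps
  ... | true  | _          | p₁ ∷ p₂ ∷ _ = along (2j+1 j) p₁ , along (2j+2 j) p₂
  ... | false | ofⁿ 2+j≰l | p₁ ∷ p₂ ∷ [] = along (cong (_∸ 1) 2l≡) p₁ , along 2l≡ p₂
    where
    2l≡ : 2 * l ≡ 2 + 2 * j
    2l≡ = trans (cong (2 *_) (≤-antisym (≤-pred (≰⇒> 2+j≰l)) j<l)) (*-suc 2 j)

  pair⊆QCycle-same : ∀ {l} j → All P (map t (QCycleIdx l (suc j))) → OnPair P t j
  pair⊆QCycle-same zero    (_ ∷ _ ∷ p₃ ∷ p₄ ∷ []) = p₃ , p₄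
  pair⊆QCycle-same (suc j) (_ ∷ _ ∷ p₃ ∷ p₄ ∷ []) = along (2j+3 j) p₃ , along (2j+4 j) p₄

  pair⊆QCycle-next : ∀ {l} j → All P (map t (QCycleIdx l (2 + j))) → OnPair P t j
  pair⊆QCycle-next j (p₁ ∷ p₂ ∷ _) = along (2j+1 j) p₁ , along (2j+2 j) p₂

  lastPair⊆QCycle-first : ∀ l → All P (map t (QCycleIdx (suc l) 1)) → OnPair P t l
  lastPair⊆QCycle-first l (p₁ ∷ p₂ ∷ _) = along (cong (_∸ 1) (*-suc 2 l)) p₁ , along (*-suc 2 l) p₂

woven : {A : Set} → (ℕ → A) → (ℕ → A) → ℕ → A
woven q t 0 = q 1
woven q t 1 = t 1
woven q t 2 = t 2
woven q t (suc (suc (suc p))) = woven (q ∘ suc) (t ∘ (2 +_)) p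

module _ {A : Set} where

  woven-q : ∀ (q t : ℕ → A) j → woven q t (3 * j) ≡ q (1 + j)
  woven-q q t zero    = refl
  woven-q q t (suc j) = trans (cong (woven q t) (*-suc 3 j)) (woven-q (q ∘ suc) (t ∘ (2 +_)) j)

  woven-t₁ : ∀ (q t : ℕ → A) j → woven q t (1 + 3 * j) ≡ t (1 + 2 * j)
  woven-t₁ q t zero    = refl
  woven-t₁ q t (suc j) = begin
    woven q t (1 + 3 * suc j)                  ≡⟨ cong (woven q t ∘ suc) (*-suc 3 j) ⟩
    woven (q ∘ suc) (t ∘ (2 +_)) (1 + 3 * j)   ≡⟨ woven-t₁ (q ∘ suc) (t ∘ (2 +_)) j ⟩
    t (2 + (1 + 2 * j))                        ≡⟨ cong (t ∘ suc) (*-suc 2 j) ⟨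
    t (1 + 2 * suc j)                          ∎
    where open ≡-Reasoning

  woven-t₂ : ∀ (q t : ℕ → A) j → woven q t (2 + 3 * j) ≡ t (2 + 2 * j)
  woven-t₂ q t zero    = refl
  woven-t₂ q t (suc j) = begin
    woven q t (2 + 3 * suc j)                  ≡⟨ cong (woven q t ∘ suc ∘ suc) (*-suc 3 j) ⟩
    woven (q ∘ suc) (t ∘ (2 +_)) (2 + 3 * j)   ≡⟨ woven-t₂ (q ∘ suc) (t ∘ (2 +_)) j ⟩
    t (2 + (2 + 2 * j))                        ≡⟨ cong (t ∘ suc ∘ suc) (*-suc 2 j) ⟨
    t (2 + 2 * suc j)                          ∎
    where open ≡-Reasoning

  interleave-suc : ∀ l (q t : ℕ → A) →
    interleave (suc l) q t ≡ q 1 ∷ t 1 ∷ t 2 ∷ interleave l (q ∘ suc) (t ∘ (2 +_))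
  interleave-suc l q t = cong (λ xs → q 1 ∷ t 1 ∷ t 2 ∷ xs) (begin
    concatMap (block q t) (applyUpTo suc l)            ≡⟨ cong (concatMap (block q t)) (map-upTo suc l) ⟨
    concatMap (block q t) (map suc (upTo l))           ≡⟨ concatMap-map (block q t) suc (upTo l) ⟩
    concatMap (block q t ∘ suc) (upTo l)               ≡⟨ concatMap-cong shift (upTo l) ⟩
    concatMap (block (q ∘ suc) (t ∘ (2 +_))) (upTo l)  ∎)
    where
    open ≡-Reasoning
    block : (ℕ → A) → (ℕ → A) → ℕ → List A
    block q t j = q (suc j) ∷ t (2 * j + 1) ∷ t (2 * j + 2) ∷ []
    shift : ∀ j → block q t (suc j) ≡ block (q ∘ suc) (t ∘ (2 +_)) j
    shift j = cong (λ i → q (2 + j) ∷ t (i + 1) ∷ t (i + 2) ∷ []) (*-suc 2 j)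

  interleave≡applyUpTo : ∀ l (q t : ℕ → A) → interleave l q t ≡ applyUpTo (woven q t) (3 * l)
  interleave≡applyUpTo zero    q t = refl
  interleave≡applyUpTo (suc l) q t = begin
    interleave (suc l) q t
      ≡⟨ interleave-suc l q t ⟩
    q 1 ∷ t 1 ∷ t 2 ∷ interleave l (q ∘ suc) (t ∘ (2 +_))
      ≡⟨ cong (λ xs → q 1 ∷ t 1 ∷ t 2 ∷ xs) (interleave≡applyUpTo l (q ∘ suc) (t ∘ (2 +_))) ⟩
    applyUpTo (woven q t) (3 + 3 * l)
      ≡⟨ cong (applyUpTo (woven q t)) (*-suc 3 l) ⟨
    applyUpTo (woven q t) (3 * suc l)
      ∎
    where open ≡-Reasoning

  interleave∷ʳ≡applyUpTo : ∀ l (q t : ℕ → A) →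
    interleave l q t ++ q (suc l) ∷ [] ≡ applyUpTo (woven q t) (1 + 3 * l)
  interleave∷ʳ≡applyUpTo l q t = begin
    interleave l q t ++ q (suc l) ∷ []
      ≡⟨ cong₂ (λ xs x → xs ++ x ∷ []) (interleave≡applyUpTo l q t) (sym (woven-q q t l)) ⟩
    applyUpTo (woven q t) (3 * l) ++ woven q t (3 * l) ∷ []
      ≡⟨ applyUpTo-∷ʳ (woven q t) (3 * l) ⟩
    applyUpTo (woven q t) (1 + 3 * l)
      ∎
    where open ≡-Reasoning

data Position : ℕ → Set where
  at-q  : ∀ j → Position (3 * j)
  at-t₁ : ∀ j → Position (1 + 3 * j)
  at-t₂ : ∀ j → Position (2 + 3 * j)

position : ∀ p → Position p
position zero = at-q 0
position (suc p) with position p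
... | at-q j  = at-t₁ j
... | at-t₁ j = at-t₂ j
... | at-t₂ j = subst Position (*-suc 3 j) (at-q (suc j))

near : ∀ {a b} → a < b → b ≤ a + 2 → b ≡ 1 + a ⊎ b ≡ 2 + a
near {a} {suc b} (s≤s a≤b) b≤a+2 with m≤n⇒m<n∨m≡n a≤b
... | inj₂ refl = inj₁ refl
... | inj₁ a<b  = inj₂ (cong suc (≤-antisym (≤-pred (subst (suc b ≤_) (+-comm a 2) b≤a+2)) a<b))

offset : ∀ {a b d} → 1 ≤ d → d ≤ 2 → a + d ≡ b → b ≡ 1 + a ⊎ b ≡ 2 + a
offset {a} {d = 1} _ _ refl = inj₁ (+-comm a 1)
offset {a} {d = 2} _ _ refl = inj₂ (+-comm a 2)
offset {d = suc (suc (suc _))} _ (s≤s (s≤s ())) _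

module _ {n : ℕ} (G : Graph n) where

  SquaredPathUpTo : ℕ → (ℕ → Fin n) → Set
  SquaredPathUpTo N f =
    (∀ {a b} → a < b → b < N → f a ≢ f b) ×
    (∀ a → 1 + a < N → Adj G (f a) (f (1 + a))) ×
    (∀ a → 2 + a < N → Adj G (f a) (f (2 + a)))

  private
    adjacent : ∀ {N f} → SquaredPathUpTo N f → ∀ {a b} → b ≡ 1 + a ⊎ b ≡ 2 + a → b < N → Adj G (f a) (f b)
    adjacent (_ , step₁ , _) {a} (inj₁ refl) = step₁ a
    adjacent (_ , _ , step₂) {a} (inj₂ refl) = step₂ a

    below : ∀ (f : ℕ → Fin n) N (i : Fin (length (applyUpTo f N))) → toℕ i < N
    below f N i = subst (toℕ i <_) (length-applyUpTo f N) (toℕ<n i)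

    lookup-adj : ∀ (f : ℕ → Fin n) N (i j : Fin (length (applyUpTo f N))) →
      Adj G (f (toℕ i)) (f (toℕ j)) → Adj G (lookup (applyUpTo f N) i) (lookup (applyUpTo f N) j)
    lookup-adj f N i j = subst₂ (Adj G) (sym (lookup-applyUpTo f N i)) (sym (lookup-applyUpTo f N j))

  squaredPath-applyUpTo : ∀ {N f} → SquaredPathUpTo N f → SquaredPath G (applyUpTo f N)
  squaredPath-applyUpTo {N} {f} sq@(distinct , _) =
    applyUpTo⁺₁ f N distinct ,
    λ i j i<j j≤i+2 → lookup-adj f N i j (adjacent sq (near i<j j≤i+2) (below f N j))

  squaredCycle-applyUpTo : ∀ {M f} → SquaredPathUpTo (2 + M) f →
    Adj G (f (1 + M)) (f 0) → Adj G (f M) (f 0) → Adj G (f (1 + M)) (f 1) →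
    SquaredCycle G (applyUpTo f (2 + M))
  squaredCycle-applyUpTo {M} {f} sq@(distinct , _) last~first penultimate~first last~second =
    applyUpTo⁺₁ f N distinct , λ where
      i j d 1≤d d≤2 (inj₁ e) → lookup-adj f N i j (adjacent sq (offset 1≤d d≤2 e) (below f N j))
      i j d 1≤d d≤2 (inj₂ e) → lookup-adj f N i j
        (wrap 1≤d d≤2 (below f N i) (trans e (cong (toℕ j +_) (length-applyUpTo f N))))
    where
    N = 2 + M
    cancel : ∀ {a c} k → a + k ≡ k + c → a ≡ c
    cancel {a} k e = +-cancelˡ-≡ k _ _ (trans (+-comm k a) e)

    wrap : ∀ {a b d} → 1 ≤ d → d ≤ 2 → a < N → a + d ≡ b + N → Adj G (f a) (f b)
    wrap {b = 0} {d = 1} _ _ _ e   = subst (λ x → Adj G (f x) (f 0)) (sym (cancel 1 e)) last~first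
    wrap {b = 0} {d = 2} _ _ _ e   = subst (λ x → Adj G (f x) (f 0)) (sym (cancel 2 e)) penultimate~first
    wrap {b = 1} {d = 1} _ _ a<N e = ⊥-elim (<-irrefl (cancel 1 e) a<N)
    wrap {b = 1} {d = 2} _ _ _ e   = subst (λ x → Adj G (f x) (f 1)) (sym (cancel 2 e)) last~second
    wrap {a} {suc (suc b)} {d} _ d≤2 a<N e = ⊥-elim (<⇒≱ a<N (≤-trans (m≤n+m N b)
      (+-cancelˡ-≤ 2 _ _ (subst₂ _≤_ e (+-comm a 2) (+-monoʳ-≤ a d≤2)))))
    wrap {d = 0} () _ _ _
    wrap {d = suc (suc (suc _))} _ (s≤s (s≤s ())) _ _

-- The first N entries of woven q t use q₁, …, q_m and t₁, …, t_{2l}.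
module Weaving {n : ℕ} (G : Graph n) (W : Fin n → Set) {l m N : ℕ} {Q : ℕ → List (Fin n)} (q t : ℕ → Fin n)
  (N≤1+3l : N ≤ 1 + 3 * l) (N≤3m : N ≤ 3 * m)
  (path : IsPath G (2 * l) t) (t∉W : ∀ a → 1 ≤ a → a ≤ 2 * l → ¬ W (t a))
  (choice : CommonNeighbourChoice G W m Q q)
  (left : ∀ {j} → j < l → OnPair (Adj G (q (1 + j))) t j)
  (right : ∀ {j} → 1 + j < m → OnPair (Adj G (q (2 + j))) t j)
  where

  q-index : ∀ j → 3 * j < N → j < m
  q-index j p = *-cancelˡ-< 3 _ _ (<-≤-trans p N≤3m)

  next-q-index : ∀ j → 3 + 3 * j < N → 1 + j < m
  next-q-index j p = q-index (suc j) (subst (_< N) (sym (*-suc 3 j)) p)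

  pair-index : ∀ j → 1 + 3 * j < N → j < l
  pair-index j p = *-cancelˡ-< 3 _ _ (≤-pred (<-≤-trans p N≤1+3l))

  next-pair-index : ∀ j → 4 + 3 * j < N → 1 + j < l
  next-pair-index j p = pair-index (suc j) (subst (_< N) (cong suc (sym (*-suc 3 j))) p)

  pair-within : ∀ {j} → j < l → 2 + 2 * j ≤ 2 * l
  pair-within {j} j<l = subst (_≤ 2 * l) (*-suc 2 j) (*-monoʳ-≤ 2 j<l)

  pair-edge : ∀ {j} → j < l → Adj G (t (1 + 2 * j)) (t (2 + 2 * j))
  pair-edge j<l = proj₂ path _ (s≤s z≤n) (pair-within j<l)

  link-edge : ∀ {j} → 1 + j < l → Adj G (t (2 + 2 * j)) (t (3 + 2 * j))
  link-edge {j} 1+j<l = proj₂ path _ (s≤s z≤n)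
    (≤-trans (n≤1+n _) (subst (_≤ 2 * l) (cong (2 +_) (*-suc 2 j)) (pair-within 1+j<l)))

  TIndex : ℕ → Set
  TIndex a = 1 ≤ a × a ≤ 2 * l

  odd : ∀ j → 1 + 3 * j < N → TIndex (1 + 2 * j)
  odd j p = s≤s z≤n , ≤-trans (n≤1+n _) (pair-within (pair-index j p))

  even : ∀ j → 2 + 3 * j < N → TIndex (2 + 2 * j)
  even j p = s≤s z≤n , pair-within (pair-index j (<-trans (n<1+n _) p))

  t-injective : ∀ {a b} → TIndex a → TIndex b → t a ≡ t b → a ≡ b
  t-injective (1≤a , a≤2l) (1≤b , b≤2l) = proj₁ path _ _ 1≤a a≤2l 1≤b b≤2l

  separated : ∀ {j a} → j < m → TIndex a → q (suc j) ≢ t a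
  separated j<m (1≤a , a≤2l) e = t∉W _ 1≤a a≤2l (subst W e (proj₁ (proj₂ choice j<m)))

  entry : ∀ {p} → Position p → Fin n
  entry (at-q j)  = q (1 + j)
  entry (at-t₁ j) = t (1 + 2 * j)
  entry (at-t₂ j) = t (2 + 2 * j)

  woven-entry : ∀ {p} (u : Position p) → woven q t p ≡ entry u
  woven-entry (at-q j)  = woven-q q t j
  woven-entry (at-t₁ j) = woven-t₁ q t j
  woven-entry (at-t₂ j) = woven-t₂ q t j

  entry-injective : ∀ {a b} (u : Position a) (v : Position b) → a < N → b < N → entry u ≡ entry v → a ≡ b
  entry-injective (at-q j) (at-q k) a<N b<N e = cong (3 *_) (proj₁ choice (q-index j a<N) (q-index k b<N) e)
  entry-injective (at-t₁ j) (at-t₁ k) a<N b<N e =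
    cong (λ x → 1 + 3 * x) (*-cancelˡ-≡ j k 2 (suc-injective (t-injective (odd j a<N) (odd k b<N) e)))
  entry-injective (at-t₂ j) (at-t₂ k) a<N b<N e =
    cong (λ x → 2 + 3 * x)
      (*-cancelˡ-≡ j k 2 (suc-injective (suc-injective (t-injective (even j a<N) (even k b<N) e))))
  entry-injective (at-t₁ j) (at-t₂ k) a<N b<N e =
    ⊥-elim (even≢odd (suc k) j (trans (*-suc 2 k) (sym (t-injective (odd j a<N) (even k b<N) e))))
  entry-injective (at-t₂ j) (at-t₁ k) a<N b<N e =
    ⊥-elim (even≢odd (suc j) k (trans (*-suc 2 j) (t-injective (even j a<N) (odd k b<N) e)))
  entry-injective (at-q j) (at-t₁ k) a<N b<N e = ⊥-elim (separated (q-index j a<N) (odd k b<N) e)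
  entry-injective (at-q j) (at-t₂ k) a<N b<N e = ⊥-elim (separated (q-index j a<N) (even k b<N) e)
  entry-injective (at-t₁ j) (at-q k) a<N b<N e = ⊥-elim (separated (q-index k b<N) (odd j a<N) (sym e))
  entry-injective (at-t₂ j) (at-q k) a<N b<N e = ⊥-elim (separated (q-index k b<N) (even j a<N) (sym e))

  woven-injective : ∀ {a b} → a < N → b < N → woven q t a ≡ woven q t b → a ≡ b
  woven-injective {a} {b} a<N b<N e =
    entry-injective (position a) (position b) a<N b<N
      (trans (sym (woven-entry (position a))) (trans e (woven-entry (position b))))

  step₁ : ∀ a → 1 + a < N → Adj G (woven q t a) (woven q t (1 + a))
  step₁ a b<N with position a
  ... | at-q j  = subst₂ (Adj G) (sym (woven-q q t j)) (sym (woven-t₁ q t j))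
                    (proj₁ (left (pair-index j b<N)))
  ... | at-t₁ j = subst₂ (Adj G) (sym (woven-t₁ q t j)) (sym (woven-t₂ q t j))
                    (pair-edge (pair-index j (<-trans (n<1+n _) b<N)))
  ... | at-t₂ j = subst₂ (Adj G) (sym (woven-t₂ q t j)) (sym (woven-q (q ∘ suc) (t ∘ (2 +_)) j))
                    (Graph.sym G (proj₂ (right (next-q-index j b<N))))

  step₂ : ∀ a → 2 + a < N → Adj G (woven q t a) (woven q t (2 + a))
  step₂ a b<N with position a
  ... | at-q j  = subst₂ (Adj G) (sym (woven-q q t j)) (sym (woven-t₂ q t j))
                    (proj₂ (left (pair-index j (<-trans (n<1+n _) b<N))))
  ... | at-t₁ j = subst₂ (Adj G) (sym (woven-t₁ q t j)) (sym (woven-q (q ∘ suc) (t ∘ (2 +_)) j))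
                    (Graph.sym G (proj₁ (right (next-q-index j b<N))))
  ... | at-t₂ j = subst₂ (Adj G) (sym (woven-t₂ q t j)) (sym (woven-t₁ (q ∘ suc) (t ∘ (2 +_)) j))
                    (link-edge (next-pair-index j b<N))

  woven-squaredPathUpTo : SquaredPathUpTo G N (woven q t)
  woven-squaredPathUpTo =
    (λ a<b b<N e → <⇒≢ a<b (woven-injective (<-trans a<b b<N) b<N e)) , step₁ , step₂

module _ {n : ℕ} (G : Graph n) (W : Fin n → Set) where

  squaredPathThrough : ∀ l (t : ℕ → Fin n) → IsPath G (2 * l) t →
    (∀ a → 1 ≤ a → a ≤ 2 * l → ¬ W (t a)) →
    (σ : Fin (suc l) ↔ Fin (suc l)) →
    (∀ (i : Fin (suc l)) → AtLeastCommonNbrsIn G W (suc (toℕ i))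
        (map t (QPathIdx l (suc (toℕ (Inverse.to σ i)))))) →
    Σ (ℕ → Fin n) λ q → (∀ i → 1 ≤ i → i ≤ suc l → W (q i)) ×
      SquaredPath G (interleave l q t ++ (q (suc l) ∷ []))
  squaredPathThrough l t path t∉W σ enough
    with chooseCommonNeighbours G W (map t ∘ QPathIdx l) σ (t 0) enough
  ... | q , choice@(_ , represents) =
    q , (λ { (suc j) _ j<m → proj₁ (represents j<m) }) ,
    subst (SquaredPath G) (sym (interleave∷ʳ≡applyUpTo l q t))
      (squaredPath-applyUpTo G woven-squaredPathUpTo)
    where
    left : ∀ {j} → j < l → OnPair (Adj G (q (1 + j))) t j
    left j<l = pair⊆QPath-same t j<l (proj₂ (represents (m<n⇒m<1+n j<l)))
    right : ∀ {j} → 1 + j < suc l → OnPair (Adj G (q (2 + j))) t j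
    right 1+j<1+l = pair⊆QPath-next t (≤-pred 1+j<1+l) (proj₂ (represents 1+j<1+l))
    open Weaving G W {Q = map t ∘ QPathIdx l} q t
      ≤-refl (subst (1 + 3 * l ≤_) (sym (*-suc 3 l)) (m≤n+m _ 2)) path t∉W choice left right

  squaredCycleThrough : ∀ l (t : ℕ → Fin n) → IsCycle G (2 * l) t →
    (∀ a → 1 ≤ a → a ≤ 2 * l → ¬ W (t a)) →
    (σ : Fin l ↔ Fin l) →
    (∀ (i : Fin l) → AtLeastCommonNbrsIn G W (suc (toℕ i))
        (map t (QCycleIdx l (suc (toℕ (Inverse.to σ i)))))) →
    Σ (ℕ → Fin n) λ q → (∀ i → 1 ≤ i → i ≤ l → W (q i)) ×
      SquaredCycle G (interleave l q t)
  squaredCycleThrough zero t (() , _)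
  squaredCycleThrough (suc l) t (_ , path , closing) t∉W σ enough
    with chooseCommonNeighbours G W (map t ∘ QCycleIdx (suc l)) σ (t 0) enough
  ... | q , choice@(_ , represents) =
    q , (λ { (suc j) _ j<m → proj₁ (represents j<m) }) ,
    subst (SquaredCycle G) (sym listing)
      (squaredCycle-applyUpTo G woven-squaredPathUpTo last~first penultimate~first last~second)
    where
    left : ∀ {j} → j < suc l → OnPair (Adj G (q (1 + j))) t j
    left {j} j<l = pair⊆QCycle-same t j (proj₂ (represents j<l))
    right : ∀ {j} → 1 + j < suc l → OnPair (Adj G (q (2 + j))) t j
    right {j} 1+j<l = pair⊆QCycle-next t {suc l} j (proj₂ (represents 1+j<l))
    open Weaving G W {Q = map t ∘ QCycleIdx (suc l)} q t
      (subst (3 + 3 * l ≤_) (cong suc (sym (*-suc 3 l))) (n≤1+n _)) (≤-reflexive (sym (*-suc 3 l)))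
      path t∉W choice left right

    listing : interleave (suc l) q t ≡ applyUpTo (woven q t) (3 + 3 * l)
    listing = trans (interleave≡applyUpTo (suc l) q t) (cong (applyUpTo (woven q t)) (*-suc 3 l))

    first : OnPair (Adj G (q 1)) t l
    first = lastPair⊆QCycle-first t l (proj₂ (represents (s≤s z≤n)))

    last~first : Adj G (woven q t (2 + 3 * l)) (q 1)
    last~first = subst (λ v → Adj G v (q 1)) (sym (woven-t₂ q t l)) (Graph.sym G (proj₂ first))
    penultimate~first : Adj G (woven q t (1 + 3 * l)) (q 1)
    penultimate~first = subst (λ v → Adj G v (q 1)) (sym (woven-t₁ q t l)) (Graph.sym G (proj₁ first))
    last~second : Adj G (woven q t (2 + 3 * l)) (t 1)
    last~second = subst (λ v → Adj G v (t 1)) (trans (cong t (*-suc 2 l)) (sym (woven-t₂ q t l))) closing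

lemma4p1 : ∀ {n : ℕ} (G : Graph n) (W : Fin n → Set) (l : ℕ) (t : ℕ → Fin n) →
    ((1 ≤ l) → IsPath G (2 * l) t →
      (∀ a → 1 ≤ a → a ≤ 2 * l → ¬ W (t a)) →
      (σ : Fin (suc l) ↔ Fin (suc l)) →
      (∀ (i : Fin (suc l)) → AtLeastCommonNbrsIn G W (suc (toℕ i))
          (map t (QPathIdx l (suc (toℕ (Inverse.to σ i)))))) →
      Σ (ℕ → Fin n) λ q → (∀ i → 1 ≤ i → i ≤ suc l → W (q i)) ×
        SquaredPath G (interleave l q t ++ (q (suc l) ∷ [])))
    ×
    (IsCycle G (2 * l) t →
      (∀ a → 1 ≤ a → a ≤ 2 * l → ¬ W (t a)) →
      (σ : Fin l ↔ Fin l) →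
      (∀ (i : Fin l) → AtLeastCommonNbrsIn G W (suc (toℕ i))
          (map t (QCycleIdx l (suc (toℕ (Inverse.to σ i)))))) →
      Σ (ℕ → Fin n) λ q → (∀ i → 1 ≤ i → i ≤ l → W (q i)) ×
        SquaredCycle G (interleave l q t))
lemma4p1 G W l t = (λ _ → squaredPathThrough G W l t) , squaredCycleThrough G W l t
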